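{- Let $A=[a_{ij}]$ be an $n\times m$ binary matrix that is semi-canonical. Then there exist integers $i,j$ with $0\le i\le n$ and $0\le j\le m$ such that $$a_{11}=a_{12}=\cdots=a_{1j}=0,\qquad a_{1\,j+1}=a_{1\,j+2}=\cdots=a_{1m}=1,$$ $$a_{11}=a_{21}=\cdots=a_{i1}=0,\qquad a_{i+1\,1}=a_{i+2\,1}=\cdots=a_{n1}=1.$$ (That is, the first row has the form $0\cdots0\,1\cdots1$ with $j$ leading zeros, and the first column has the form $0\cdots0\,1\cdots1$ read from top to bottom with $i$ leading zeros; empty runs are allowed.)
   Context: A binary matrix is a matrix with entries in $\{0,1\}$; $\mathfrak{B}_{n\times m}$ denotes the set of all $n\times m$ binary matrices. For $A\in\mathfrak{B}_{n\times m}$, let $r(A)=\langle x_1,\dots,x_n\rangle$, where $x_i$ is the nonnegative integer whose binary representation is the $i$-th row of $A$ read from left to right (the entry in column 1 is the most significant bit), so $x_i=\sum_{j=1}^m a_{ij}2^{m-j}$; similarly $c(A)=\langle y_1,\dots,y_m\rangle$, where $y_j=\sum_{i=1}^n a_{ij}2^{n-i}$ is the integer whose binary representation is the $j$-th column read from top to bottom. $A$ is called semi-canonical if $x_1\le x_2\le\cdots\le x_n$ and $y_1\le y_2\le\cdots\le y_m$. -}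

module Defs where

open import Data.Nat using (ℕ; zero; suc; _+_; _*_; _^_; _≤_; _<_)
open import Data.Fin using (Fin; toℕ; zero; suc)
open import Data.Bool using (Bool; true; false)
open import Data.Product using (_×_)

-- A binary matrix in 𝔅_{n×m}: entries a i j ∈ {0,1} encoded as Bool (false = 0, true = 1).
-- Indices are 0-based: row i : Fin n corresponds to the paper's row (toℕ i + 1).
BinMatrix : ℕ → ℕ → Set
BinMatrix n m = Fin n → Fin m → Bool

bit : Bool → ℕ
bit false = 0
bit true  = 1

binVal : (k : ℕ) → (Fin k → Bool) → ℕ
binVal zero    w = 0
binVal (suc k) w = bit (w zero) * 2 ^ k + binVal k (λ j → w (suc j))

rowVal : ∀ {n m} → BinMatrix n m → Fin n → ℕ
rowVal {n} {m} A i = binVal m (λ j → A i j)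

colVal : ∀ {n m} → BinMatrix n m → Fin m → ℕ
colVal {n} {m} A j = binVal n (λ i → A i j)

SemiCanonical : ∀ {n m} → BinMatrix n m → Set
SemiCanonical {n} {m} A =
  ((i i' : Fin n) → toℕ i ≤ toℕ i' → rowVal A i ≤ rowVal A i') ×
  ((j j' : Fin m) → toℕ j ≤ toℕ j' → colVal A j ≤ colVal A j')

-- In each column read top to bottom, the entry of the first row is the leading bit of the
-- column value, and a bit-string value ≥ 2^k iff its leading bit (of weight 2^k) is set.
-- So along the sorted column values the first-row entries never drop from 1 to 0, i.e. the
-- first row reads 0⋯01⋯1; the first column is the first row of the transposed matrix, which
-- is again semi-canonical.
module Submission where

open import Defs
open import Data.Nat using (ℕ; _≤_; _<_; zero; suc; _+_; _*_; _^_; z≤n; s≤s)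
open import Data.Nat.Properties
open import Data.Fin using (Fin; toℕ; zero; suc)
open import Data.Fin.Properties using (toℕ-injective)
open import Data.Bool using (Bool; true; false)
open import Data.Product using (Σ; _×_; _,_; proj₁; proj₂; swap)
open import Relation.Nullary using (contradiction)
open import Relation.Binary.PropositionalEquality using (_≡_; refl; sym; subst)

bit≤1 : ∀ b → bit b ≤ 1
bit≤1 false = z≤n
bit≤1 true  = s≤s z≤n

binVal<2^ : ∀ k w → binVal k w < 2 ^ k
binVal<2^ zero    w = s≤s z≤n
binVal<2^ (suc k) w = begin-strict
  bit (w zero) * 2 ^ k + binVal k (λ j → w (suc j)) <⟨ +-mono-≤-< (*-monoˡ-≤ (2 ^ k) (bit≤1 (w zero)))
                                                                 (binVal<2^ k (λ j → w (suc j))) ⟩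
  1 * 2 ^ k + 2 ^ k                                 ≡⟨ +-comm (1 * 2 ^ k) (2 ^ k) ⟩
  2 ^ suc k                                         ∎
  where open ≤-Reasoning

2^≤binVal : ∀ k (w : Fin (suc k) → Bool) → w zero ≡ true → 2 ^ k ≤ binVal (suc k) w
2^≤binVal k w w₀ rewrite w₀ = ≤-trans (≤-reflexive (sym (*-identityˡ (2 ^ k)))) (m≤m+n _ _)

binVal<2^-leadingBit-false : ∀ k (w : Fin (suc k) → Bool) → w zero ≡ false → binVal (suc k) w < 2 ^ k
binVal<2^-leadingBit-false k w w₀ rewrite w₀ = binVal<2^ k (λ j → w (suc j))

binVal-leadingBit-mono : ∀ k (w w′ : Fin (suc k) → Bool) →
  binVal (suc k) w ≤ binVal (suc k) w′ → w zero ≡ true → w′ zero ≡ true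
binVal-leadingBit-mono k w w′ w≤w′ w₀ = byLeadingBit (w′ zero) refl
  where
  byLeadingBit : ∀ b → w′ zero ≡ b → w′ zero ≡ true
  byLeadingBit true  w′₀ = w′₀
  byLeadingBit false w′₀ = contradiction
    (≤-<-trans (≤-trans (2^≤binVal k w w₀) w≤w′) (binVal<2^-leadingBit-false k w′ w′₀)) (<-irrefl refl)

UpwardClosed : ∀ {m} → (Fin m → Bool) → Set
UpwardClosed {m} g = (j j′ : Fin m) → toℕ j ≤ toℕ j′ → g j ≡ true → g j′ ≡ true

ZerosThenOnes : ∀ {m} → ℕ → (Fin m → Bool) → Set
ZerosThenOnes {m} j g = (k : Fin m) → (toℕ k < j → g k ≡ false) × (j ≤ toℕ k → g k ≡ true)

upwardClosed⇒zerosThenOnes : ∀ m (g : Fin m → Bool) → UpwardClosed g →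
  Σ ℕ (λ j → (j ≤ m) × ZerosThenOnes j g)
upwardClosed⇒zerosThenOnes zero    g up = 0 , z≤n , λ ()
upwardClosed⇒zerosThenOnes (suc m) g up with g zero in g₀
... | true  = 0 , z≤n , λ k → (λ ()) , (λ _ → up zero k z≤n g₀)
... | false with upwardClosed⇒zerosThenOnes m (λ k → g (suc k)) (λ j j′ j≤j′ → up (suc j) (suc j′) (s≤s j≤j′))
...   | j , j≤m , tail = suc j , s≤s j≤m , shifted
  where
  shifted : ZerosThenOnes (suc j) g
  shifted zero    = (λ _ → g₀) , (λ ())
  shifted (suc k) = (λ { (s≤s k<j) → proj₁ (tail k) k<j }) , (λ { (s≤s j≤k) → proj₂ (tail k) j≤k })

transpose : ∀ {n m} → BinMatrix n m → BinMatrix m n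
transpose A j i = A i j

semiCanonical-transpose : ∀ {n m} (A : BinMatrix n m) → SemiCanonical A → SemiCanonical (transpose A)
semiCanonical-transpose A = swap

topRow-upwardClosed : ∀ {n m} (A : BinMatrix (suc n) m) → SemiCanonical A → UpwardClosed (A zero)
topRow-upwardClosed {n} A (_ , cols-sorted) j j′ j≤j′ =
  binVal-leadingBit-mono n (λ i → A i j) (λ i → A i j′) (cols-sorted j j′ j≤j′)

firstRow-zerosThenOnes : ∀ n m (A : BinMatrix n m) → SemiCanonical A →
  Σ ℕ (λ j → (j ≤ m) × ((r : Fin n) → toℕ r ≡ 0 → ZerosThenOnes j (A r)))
firstRow-zerosThenOnes zero    m A sc = 0 , z≤n , λ ()
firstRow-zerosThenOnes (suc n) m A sc
  with upwardClosed⇒zerosThenOnes m (A zero) (topRow-upwardClosed A sc)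
... | j , j≤m , topRow =
  j , j≤m , λ r r≡0 → subst (λ r → ZerosThenOnes j (A r)) (sym (toℕ-injective r≡0)) topRow

proposition3 : (n m : ℕ) → (A : BinMatrix n m) → SemiCanonical A →
    Σ ℕ (λ i → Σ ℕ (λ j → (i ≤ n) × (j ≤ m) ×
      ((r : Fin n) → toℕ r ≡ 0 → (k : Fin m) →
         (toℕ k < j → A r k ≡ false) × (j ≤ toℕ k → A r k ≡ true)) ×
      ((c : Fin m) → toℕ c ≡ 0 → (k : Fin n) →
         (toℕ k < i → A k c ≡ false) × (i ≤ toℕ k → A k c ≡ true))))
proposition3 n m A sc with firstRow-zerosThenOnes n m A sc
                         | firstRow-zerosThenOnes m n (transpose A) (semiCanonical-transpose A sc)
... | j , j≤m , firstRow | i , i≤n , firstColumn = i , j , i≤n , j≤m , firstRow , firstColumn
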